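{- Let $G$ be a connected graph. If the graph associahedron $\mathcal{A}(G)$ has a facet-Hamiltonian cycle all of whose vertices are nested tubings, then $G$ has a Hamiltonian cycle.
   Context: For a connected graph $G=(V,E)$, a tube is a nonempty proper subset $t\subsetneq V$ with $G[t]$ connected; two distinct tubes are compatible if they are nested (one contains the other) or non-adjacent ($G[t_1\cup t_2]$ disconnected); a tubing is a set of pairwise compatible tubes. The graph associahedron $\mathcal{A}(G)$ has vertices the maximal tubings, facets the tubes (a vertex lies on the facet of $t$ iff $t$ is in the tubing), and edges between maximal tubings differing in exactly one tube. A nested tubing is a maximal tubing whose tubes are pairwise nested. A cycle $C$ in the vertex-edge graph of a polytope is facet-Hamiltonian if for every facet $f$, $f\cap C$ is nonempty and connected. -}

module Defs where

open import Data.Nat using (ℕ; zero; suc; _≤_)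
open import Data.Nat.DivMod using (_mod_)
open import Data.Fin using (Fin; toℕ)
open import Data.Fin.Subset using (Subset; _∈_; _∉_; _⊆_; _⊂_; _∪_; ⊤; Nonempty)
open import Data.Product using (Σ; _×_; ∃; _,_)
open import Data.Sum using (_⊎_)
open import Relation.Nullary using (¬_)
open import Relation.Binary.PropositionalEquality using (_≡_; _≢_)
open import Function.Definitions using (Injective)
open import Function.Bundles using (_⇔_)

record Graph (n : ℕ) : Set₁ where
  field
    Adj     : Fin n → Fin n → Set
    symm    : ∀ {x y} → Adj x y → Adj y x
    irrefl  : ∀ {x} → ¬ Adj x x

data WalkIn {A : Set} (R : A → A → Set) (P : A → Set) : A → A → Set where
  here : ∀ {x} → P x → WalkIn R P x x
  step : ∀ {x y z} → P x → R x y → WalkIn R P y z → WalkIn R P x z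

ConnectedOn : {A : Set} → (A → A → Set) → (A → Set) → Set
ConnectedOn R P = (∃ λ x → P x) × (∀ x y → P x → P y → WalkIn R P x y)

module _ {n : ℕ} (G : Graph n) where
  open Graph G

  InducedConnected : Subset n → Set
  InducedConnected S = ConnectedOn Adj (λ x → x ∈ S)

  IsConnectedGraph : Set
  IsConnectedGraph = InducedConnected ⊤

  IsTube : Subset n → Set
  IsTube t = Nonempty t × t ⊂ ⊤ × InducedConnected t

  -- compatibility: nested, or non-adjacent (G[t₁ ∪ t₂] disconnected)
  -- (for t₁ = t₂ the "nested" case holds trivially, so this is harmless)
  Compatible : Subset n → Subset n → Set
  Compatible t₁ t₂ = t₁ ⊆ t₂ ⊎ t₂ ⊆ t₁ ⊎ ¬ InducedConnected (t₁ ∪ t₂)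

  Collection : Set₁
  Collection = Subset n → Set

  IsTubing : Collection → Set
  IsTubing T = (∀ t → T t → IsTube t) × (∀ s t → T s → T t → Compatible s t)

  IsMaximalTubing : Collection → Set
  IsMaximalTubing T =
    IsTubing T × (∀ t → IsTube t → (∀ s → T s → Compatible s t) → T t)

  IsNestedTubing : Collection → Set
  IsNestedTubing T =
    IsMaximalTubing T × (∀ s t → T s → T t → s ⊆ t ⊎ t ⊆ s)

  SameTubing : Collection → Collection → Set
  SameTubing T T' = ∀ t → T t ⇔ T' t

  DifferInOneTube : Collection → Collection → Set
  DifferInOneTube T T' =
    Σ (Subset n) λ t → Σ (Subset n) λ t' →
      (T t × ¬ T' t) × (T' t' × ¬ T t') ×
      (∀ s → T s → ¬ T' s → s ≡ t) × (∀ s → T' s → ¬ T s → s ≡ t')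

next : ∀ {k} → Fin k → Fin k
next {suc m} i = suc (toℕ i) mod (suc m)

CycAdj : ∀ {k} → Fin k → Fin k → Set
CycAdj i j = j ≡ next i ⊎ i ≡ next j

module _ {n : ℕ} (G : Graph n) where
  open Graph G

  record AssocCycle : Set₁ where
    field
      m        : ℕ
      length≥3 : 2 ≤ m
      vertex   : Fin (suc m) → Collection G
      maximal  : ∀ i → IsMaximalTubing G (vertex i)
      distinct : ∀ i j → SameTubing G (vertex i) (vertex j) → i ≡ j
      edge     : ∀ i → DifferInOneTube G (vertex i) (vertex (next i))

  -- facet-Hamiltonian: for every tube t (facet), the set of cycle
  -- vertices lying on the facet of t, with the cycle edges between
  -- them, is nonempty and connected.
  IsFacetHamiltonian : AssocCycle → Set
  IsFacetHamiltonian C =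
    ∀ t → IsTube G t → ConnectedOn CycAdj (λ i → vertex i t)
    where open AssocCycle C

  HasHamiltonianCycle : Set
  HasHamiltonianCycle =
    3 ≤ n × Σ (Fin n → Fin n) λ σ →
      Injective _≡_ _≡_ σ × (∀ i → Adj (σ i) (σ (next i)))

-- Every nested tubing of the cycle contains exactly one singleton tube ⁅ b ⁆, its bottom.
-- Across an edge of A(G) the bottom changes only when ⁅ b ⁆ itself is flipped, and then the
-- old and new bottoms z, x are adjacent in G: every other tube contains both, so if z and x
-- were not adjacent, ⁅ x ⁆ would be compatible with the old tubing and give it a second
-- singleton. Facet-Hamiltonicity of the facet ⁅ z ⁆ makes the tubings with bottom z an arc
-- of the cycle; hence "the bottom right after the arc of z" is an injective successor map
-- along the edges of G. Around the cycle the bottom only ever moves to its successor, so all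
-- vertices lie in one orbit, which is therefore a Hamiltonian cycle. On at most two vertices
-- every tube is a singleton, which leaves fewer than three nested tubings, too few for a cycle.

module Submission where

open import Defs
open import Data.Bool using (true; false)
import Data.Bool.Properties as Bool
open import Data.Empty using (⊥-elim)
open import Data.Fin as Fin using (Fin; toℕ; fromℕ<; zero; suc; punchIn)
open import Data.Fin.Properties
  using (toℕ-fromℕ<; toℕ-injective; toℕ<n; injective⇒≤; pigeonhole; any?; punchInᵢ≢i; punchIn-injective; punchIn-punchOut)
open import Data.Fin.Subset using (Subset; _∈_; _∉_; _⊆_; _∪_; ⁅_⁆)
open import Data.Fin.Subset.Properties using (∉⊥; _⊆?_; x∈⁅x⁆; x∈⁅y⁆⇒x≡y; x≢y⇒x∉⁅y⁆; ∈⊤; ⊆⊤; x∈p∪q⁻; x∈p∪q⁺)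
open import Data.Nat as ℕ using (ℕ; zero; suc; _+_; _*_; _∸_; _/_; _%_; _≤_; _<_; z≤n; s≤s)
open import Data.Nat.DivMod using (m%n<n; m≡m%n+[m/n]*n; m<n⇒m%n≡m; n%n≡0; %-distribˡ-+; m%n%n≡m%n; [m+n]%n≡m%n; %-pred-≡0)
open import Data.Nat.GeneralisedArithmetic using (fold; fold-+)
open import Data.Nat.Properties
open import Data.Product using (_×_; ∃; _,_; proj₁; proj₂)
open import Data.Sum using (_⊎_; inj₁; inj₂; [_,_]′)
open import Data.Vec using (_∷_; [])
open import Data.Vec.Properties using (≡-dec)
open import Function.Base using (_∘_)
open import Function.Bundles using (_⇔_; mk⇔; Equivalence)
open import Function.Definitions using (Injective)
import Function.Properties.Equivalence as ⇔
open import Relation.Binary.Definitions using (DecidableEquality; tri<; tri≈; tri>)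
open import Relation.Binary.PropositionalEquality
open import Relation.Nullary using (¬_; contradiction; yes; no; ¬?)
open import Relation.Nullary.Decidable using (decidable-stable; _⊎-dec_; _×-dec_)

walk-start : ∀ {A : Set} {R : A → A → Set} {P : A → Set} {a b} → WalkIn R P a b → P a
walk-start (here Pa) = Pa
walk-start (step Pa _ _) = Pa

walk-end : ∀ {A : Set} {R : A → A → Set} {P : A → Set} {a b} → WalkIn R P a b → P b
walk-end (here Pb) = Pb
walk-end (step _ _ w) = walk-end w

walk-map : ∀ {A : Set} {R : A → A → Set} {P P' : A → Set} → (∀ {x} → P x → P' x) →
           ∀ {a b} → WalkIn R P a b → WalkIn R P' a b
walk-map P⇒P' (here Pa) = here (P⇒P' Pa)
walk-map P⇒P' (step Pa Rab w) = step (P⇒P' Pa) Rab (walk-map P⇒P' w)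

-- Cyclic order on Fin (suc m)

[m+n%d]%d≡[m+n]%d : ∀ m n d .{{_ : ℕ.NonZero d}} → (m + n % d) % d ≡ (m + n) % d
[m+n%d]%d≡[m+n]%d m n d = begin
  (m + n % d) % d            ≡⟨ %-distribˡ-+ m (n % d) d ⟩
  (m % d + n % d % d) % d    ≡⟨ cong (λ k → (m % d + k) % d) (m%n%n≡m%n n d) ⟩
  (m % d + n % d) % d        ≡⟨ %-distribˡ-+ m n d ⟨
  (m + n) % d                ∎
  where open ≡-Reasoning

module CyclicOrder {m : ℕ} where

  private
    K : ℕ
    K = suc m

  -- The number of next-steps from p to y.
  dist : Fin K → Fin K → ℕ
  dist p y = (toℕ y + (K ∸ toℕ p)) % K

  dist<K : ∀ p y → dist p y < K
  dist<K p y = m%n<n (toℕ y + (K ∸ toℕ p)) K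

  toℕ-next : ∀ (y : Fin K) → toℕ (next y) ≡ suc (toℕ y) % K
  toℕ-next y = toℕ-fromℕ< _

  dist-self : ∀ p → dist p p ≡ 0
  dist-self p = trans (cong (_% K) (m+[n∸m]≡n (<⇒≤ (toℕ<n p)))) (n%n≡0 K)

  dist-next : ∀ p y → dist p (next y) ≡ suc (dist p y) % K
  dist-next p y = begin
    (toℕ (next y) + c) % K     ≡⟨ cong (λ k → (k + c) % K) (toℕ-next y) ⟩
    (suc (toℕ y) % K + c) % K  ≡⟨ cong (_% K) (+-comm (suc (toℕ y) % K) c) ⟩
    (c + suc (toℕ y) % K) % K  ≡⟨ [m+n%d]%d≡[m+n]%d c (suc (toℕ y)) K ⟩
    (c + suc (toℕ y)) % K      ≡⟨ cong (_% K) (trans (+-suc c (toℕ y)) (cong suc (+-comm c (toℕ y)))) ⟩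
    suc (toℕ y + c) % K        ≡⟨ [m+n%d]%d≡[m+n]%d 1 (toℕ y + c) K ⟨
    suc (dist p y) % K         ∎
    where
    open ≡-Reasoning
    c : ℕ
    c = K ∸ toℕ p

  dist-inverse : ∀ p y → (dist p y + toℕ p) % K ≡ toℕ y
  dist-inverse p y = begin
    ((toℕ y + c) % K + toℕ p) % K  ≡⟨ cong (_% K) (+-comm ((toℕ y + c) % K) (toℕ p)) ⟩
    (toℕ p + (toℕ y + c) % K) % K  ≡⟨ [m+n%d]%d≡[m+n]%d (toℕ p) (toℕ y + c) K ⟩
    (toℕ p + (toℕ y + c)) % K      ≡⟨ cong (_% K) (+-comm (toℕ p) (toℕ y + c)) ⟩
    (toℕ y + c + toℕ p) % K        ≡⟨ cong (_% K) (+-assoc (toℕ y) c (toℕ p)) ⟩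
    (toℕ y + (c + toℕ p)) % K      ≡⟨ cong (λ k → (toℕ y + k) % K) (m∸n+n≡m (<⇒≤ (toℕ<n p))) ⟩
    (toℕ y + K) % K                ≡⟨ [m+n]%n≡m%n (toℕ y) K ⟩
    toℕ y % K                      ≡⟨ m<n⇒m%n≡m (toℕ<n y) ⟩
    toℕ y                          ∎
    where
    open ≡-Reasoning
    c : ℕ
    c = K ∸ toℕ p

  dist-injective : ∀ p {y y'} → dist p y ≡ dist p y' → y ≡ y'
  dist-injective p {y} {y'} eq = toℕ-injective (begin
    toℕ y                     ≡⟨ dist-inverse p y ⟨
    (dist p y + toℕ p) % K    ≡⟨ cong (λ d → (d + toℕ p) % K) eq ⟩
    (dist p y' + toℕ p) % K   ≡⟨ dist-inverse p y' ⟩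
    toℕ y'                    ∎)
    where open ≡-Reasoning

  dist-next-≢ : ∀ {p y} → next y ≢ p → dist p (next y) ≡ suc (dist p y)
  dist-next-≢ {p} {y} next≢p with m≤n⇒m<n∨m≡n (dist<K p y)
  ... | inj₁ 1+d<K = trans (dist-next p y) (m<n⇒m%n≡m 1+d<K)
  ... | inj₂ 1+d≡K = contradiction (dist-injective p (begin
        dist p (next y)     ≡⟨ dist-next p y ⟩
        suc (dist p y) % K  ≡⟨ cong (_% K) 1+d≡K ⟩
        K % K               ≡⟨ n%n≡0 K ⟩
        0                   ≡⟨ dist-self p ⟨
        dist p p            ∎)) next≢p
    where open ≡-Reasoning

  dist-next-≡ : ∀ {p y} → next y ≡ p → dist p y ≡ m
  dist-next-≡ {p} {y} refl = begin
    dist p y      ≡⟨ m%n%n≡m%n (toℕ y + (K ∸ toℕ p)) K ⟨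
    dist p y % K  ≡⟨ %-pred-≡0 (trans (sym (dist-next p y)) (dist-self p)) ⟩
    m             ∎
    where open ≡-Reasoning

  next-injective : ∀ {a b : Fin K} → next a ≡ next b → a ≡ b
  next-injective {a} {b} eq = dist-injective (next a) (trans (dist-next-≡ {y = a} refl) (sym (dist-next-≡ (sym eq))))

  dist-fold-next : ∀ p d → dist p (fold p next d) ≡ d % K
  dist-fold-next p zero = dist-self p
  dist-fold-next p (suc d) = begin
    dist p (next (fold p next d))  ≡⟨ dist-next p _ ⟩
    suc (dist p (fold p next d)) % K ≡⟨ cong (λ k → suc k % K) (dist-fold-next p d) ⟩
    suc (d % K) % K ≡⟨ [m+n%d]%d≡[m+n]%d 1 d K ⟩
    suc d % K ∎
    where open ≡-Reasoning

  cycle-induction : ∀ {ℓ} (P : Fin K → Set ℓ) {p} → P p → (∀ i → P i → P (next i)) → ∀ j → P j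
  cycle-induction P {p} Pp P-next j = subst P reaches (P-fold (dist p j))
    where
    P-fold : ∀ d → P (fold p next d)
    P-fold zero = Pp
    P-fold (suc d) = P-next _ (P-fold d)
    reaches : fold p next (dist p j) ≡ j
    reaches = dist-injective p (trans (dist-fold-next p (dist p j)) (m<n⇒m%n≡m (dist<K p j)))

  module _ (Q : Fin K → Set) where

    avoids : ∀ {x y} → ¬ Q x → Q y → y ≢ x
    avoids x∉Q Qy refl = x∉Q Qy

    -- A walk inside Q cannot pass from one of the two arcs cut out by p, q ∉ Q to the other.
    module _ {p q} (p∉Q : ¬ Q p) (q∉Q : ¬ Q q) where

      Before : Fin K → Set
      Before y = dist p y < dist p q

      before-next : ∀ y → Q (next y) → Before y ⇔ Before (next y)
      before-next y Q-next = mk⇔ forward backward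
        where
        step-dist : dist p (next y) ≡ suc (dist p y)
        step-dist = dist-next-≢ λ next≡p → p∉Q (subst Q next≡p Q-next)
        forward : Before y → Before (next y)
        forward d<q = subst (_< dist p q) (sym step-dist)
          (≤∧≢⇒< d<q λ eq → q∉Q (subst Q (dist-injective p (trans step-dist eq)) Q-next))
        backward : Before (next y) → Before y
        backward d+1<q = <-trans (n<1+n (dist p y)) (subst (_< dist p q) step-dist d+1<q)

      walk-preserves-before : ∀ {a b} → WalkIn CycAdj Q a b → Before a ⇔ Before b
      walk-preserves-before (here _) = ⇔.refl
      walk-preserves-before (step {x} _ (inj₁ refl) w) =
        ⇔.trans (before-next x (walk-start w)) (walk-preserves-before w)
      walk-preserves-before (step {y = y} Qx (inj₂ refl) w) =
        ⇔.trans (⇔.sym (before-next y Qx)) (walk-preserves-before w)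

    exit-unique : ∀ {a b} → WalkIn CycAdj Q a b → ¬ Q (next a) → ¬ Q (next b) → a ≡ b
    exit-unique {a} {b} w a-exits b-exits = decidable-stable (a Fin.≟ b) λ a≢b →
      let next-b≢next-a : next b ≢ next a
          next-b≢next-a eq = a≢b (next-injective (sym eq))
          b-before : Before a-exits b-exits b
          b-before = subst (dist (next a) b <_) (sym (dist-next-≢ next-b≢next-a)) (n<1+n _)
          a-not-before : ¬ Before a-exits b-exits a
          a-not-before a<q = <⇒≱ a<q (subst (dist (next a) (next b) ≤_) (sym (dist-next-≡ {y = a} refl))
                                              (≤-pred (dist<K (next a) (next b))))
      in a-not-before (Equivalence.from (walk-preserves-before a-exits b-exits w) b-before)

    entry-unique : ∀ {a b} → WalkIn CycAdj Q (next a) (next b) → ¬ Q a → ¬ Q b → a ≡ b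
    entry-unique {a} {b} w a∉Q b∉Q = decidable-stable (a Fin.≟ b) λ a≢b →
      let dist-next-a : dist a (next a) ≡ 1
          dist-next-a = trans (dist-next-≢ (avoids a∉Q (walk-start w))) (cong suc (dist-self a))
          0<dist : 0 < dist a b
          0<dist = ≤∧≢⇒< z≤n λ 0≡d → a≢b (dist-injective a (trans (dist-self a) 0≡d))
          next-a-before : Before a∉Q b∉Q (next a)
          next-a-before = subst (_< dist a b) (sym dist-next-a)
            (≤∧≢⇒< 0<dist λ 1≡d → b∉Q (subst Q (dist-injective a (trans dist-next-a 1≡d)) (walk-start w)))
          next-b-not-before : ¬ Before a∉Q b∉Q (next b)
          next-b-not-before lt = <-irrefl refl (<-trans (n<1+n (dist a b))
            (subst (_< dist a b) (dist-next-≢ (avoids a∉Q (walk-end w))) lt))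
      in next-b-not-before (Equivalence.to (walk-preserves-before a∉Q b∉Q w) next-a-before)

-- Orbits of an injective map

module Orbit {n} {f : Fin n → Fin n} (f-injective : Injective _≡_ _≡_ f) where

  Periodic : Fin n → ℕ → Set
  Periodic x d = fold x f d ≡ x

  fold-shift : ∀ x d → fold (f x) f d ≡ f (fold x f d)
  fold-shift x zero = refl
  fold-shift x (suc d) = cong f (fold-shift x d)

  periodic-fold⇒periodic : ∀ {x} i {d} → Periodic (fold x f i) d → Periodic x d
  periodic-fold⇒periodic zero eq = eq
  periodic-fold⇒periodic {x} (suc i) {d} eq =
    periodic-fold⇒periodic i {d} (f-injective (trans (sym (fold-shift (fold x f i) d)) eq))

  periodic-* : ∀ {x d} → Periodic x d → ∀ q → Periodic x (q * d)
  periodic-* eq zero = refl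
  periodic-* {x} {d} eq (suc q) = begin
    fold x f (d + q * d)           ≡⟨ fold-+ x f d ⟩
    fold (fold x f (q * d)) f d    ≡⟨ cong (λ y → fold y f d) (periodic-* eq q) ⟩
    fold x f d                     ≡⟨ eq ⟩
    x                              ∎
    where open ≡-Reasoning

  periodic-% : ∀ {x d} .{{_ : ℕ.NonZero d}} → Periodic x d → ∀ k → fold x f (k % d) ≡ fold x f k
  periodic-% {x} {d} eq k = begin
    fold x f (k % d)                       ≡⟨ cong (λ y → fold y f (k % d)) (periodic-* eq (k / d)) ⟨
    fold (fold x f (k / d * d)) f (k % d)  ≡⟨ fold-+ x f (k % d) ⟨
    fold x f (k % d + k / d * d)           ≡⟨ cong (fold x f) (m≡m%n+[m/n]*n k d) ⟨
    fold x f k                             ∎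
    where open ≡-Reasoning

  repetition⇒periodic : ∀ {x i j} → i ≤ j → fold x f i ≡ fold x f j → Periodic x (j ∸ i)
  repetition⇒periodic {x} {i} {j} i≤j eq = periodic-fold⇒periodic i {j ∸ i} (begin
    fold (fold x f i) f (j ∸ i)    ≡⟨ fold-+ x f (j ∸ i) ⟨
    fold x f (j ∸ i + i)           ≡⟨ cong (fold x f) (m∸n+n≡m i≤j) ⟩
    fold x f j                     ≡⟨ eq ⟨
    fold x f i                     ∎)
    where open ≡-Reasoning

  module _ {x₀ : Fin n} (orbit : ∀ y → ∃ λ k → fold x₀ f k ≡ y) where

    period-≥ : ∀ d .{{_ : ℕ.NonZero d}} → Periodic x₀ d → n ≤ d
    period-≥ d periodic = injective⇒≤ {f = residue} residue-injective
      where
      residue : Fin n → Fin d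
      residue y = fromℕ< (m%n<n (proj₁ (orbit y)) d)
      residue-injective : Injective _≡_ _≡_ residue
      residue-injective {y} {y'} same = begin
        y                                  ≡⟨ proj₂ (orbit y) ⟨
        fold x₀ f (proj₁ (orbit y))        ≡⟨ periodic-% periodic _ ⟨
        fold x₀ f (proj₁ (orbit y) % d)    ≡⟨ cong (fold x₀ f) same-residue ⟩
        fold x₀ f (proj₁ (orbit y') % d)   ≡⟨ periodic-% periodic _ ⟩
        fold x₀ f (proj₁ (orbit y'))       ≡⟨ proj₂ (orbit y') ⟩
        y'                                 ∎
        where
        open ≡-Reasoning
        same-residue : proj₁ (orbit y) % d ≡ proj₁ (orbit y') % d
        same-residue = trans (sym (toℕ-fromℕ< _)) (trans (cong toℕ same) (toℕ-fromℕ< _))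

    repetition-gap-≥ : ∀ {i j} → i < j → fold x₀ f i ≡ fold x₀ f j → n ≤ j ∸ i
    repetition-gap-≥ {i} {j} i<j eq =
      period-≥ (j ∸ i) {{ℕ.>-nonZero (m<n⇒0<n∸m i<j)}} (repetition⇒periodic (<⇒≤ i<j) eq)

    orbit-injective : ∀ {i j} → i < n → j < n → fold x₀ f i ≡ fold x₀ f j → i ≡ j
    orbit-injective {i} {j} i<n j<n eq with <-cmp i j
    ... | tri≈ _ i≡j _ = i≡j
    ... | tri< i<j _ _ = contradiction (≤-trans (repetition-gap-≥ i<j eq) (m∸n≤m j i)) (<⇒≱ j<n)
    ... | tri> _ _ j<i = contradiction (≤-trans (repetition-gap-≥ j<i (sym eq)) (m∸n≤m i j)) (<⇒≱ i<n)

    periodic-n : Periodic x₀ n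
    periodic-n with i , j , i<j , eq ← pigeonhole (n<1+n n) (λ k → fold x₀ f (toℕ k)) =
      subst (Periodic x₀) gap≡n (repetition⇒periodic (<⇒≤ i<j) eq)
      where
      gap≡n : toℕ j ∸ toℕ i ≡ n
      gap≡n = ≤-antisym (≤-trans (m∸n≤m (toℕ j) (toℕ i)) (≤-pred (toℕ<n j))) (repetition-gap-≥ i<j eq)

hamiltonian-cycle-from-successor :
  ∀ {n} (G : Graph n) → 3 ≤ n → (f : Fin n → Fin n) → Injective _≡_ _≡_ f →
  (∀ z → Graph.Adj G z (f z)) → (x₀ : Fin n) → (∀ y → ∃ λ k → fold x₀ f k ≡ y) →
  HasHamiltonianCycle G
hamiltonian-cycle-from-successor {suc n} G 3≤n f f-injective adjacent x₀ orbit =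
  3≤n , σ , σ-injective , λ j → subst (Graph.Adj G (σ j)) (σ-next j) (adjacent (σ j))
  where
  open Orbit f-injective
  σ : Fin (suc n) → Fin (suc n)
  σ j = fold x₀ f (toℕ j)
  σ-injective : Injective _≡_ _≡_ σ
  σ-injective eq = toℕ-injective (orbit-injective orbit (toℕ<n _) (toℕ<n _) eq)
  σ-next : ∀ j → f (σ j) ≡ σ (next j)
  σ-next j = begin
    fold x₀ f (suc (toℕ j))           ≡⟨ periodic-% {d = suc n} (periodic-n orbit) (suc (toℕ j)) ⟨
    fold x₀ f (suc (toℕ j) % suc n)   ≡⟨ cong (fold x₀ f) (CyclicOrder.toℕ-next j) ⟨
    fold x₀ f (toℕ (next j))          ∎
    where open ≡-Reasoning

-- Nested tubings and flips

_≟ˢ_ : ∀ {n} → DecidableEquality (Subset n)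
_≟ˢ_ = ≡-dec Bool._≟_

x∈p⇒⁅x⁆⊆p : ∀ {n} {x : Fin n} {p} → x ∈ p → ⁅ x ⁆ ⊆ p
x∈p⇒⁅x⁆⊆p {x = x} x∈p y∈⁅x⁆ = subst (_∈ _) (sym (x∈⁅y⁆⇒x≡y x y∈⁅x⁆)) x∈p

x∈p∧y∈p⇒⁅x⁆∪⁅y⁆⊆p : ∀ {n} {z x : Fin n} {s} → z ∈ s → x ∈ s → ⁅ z ⁆ ∪ ⁅ x ⁆ ⊆ s
x∈p∧y∈p⇒⁅x⁆∪⁅y⁆⊆p {z = z} {x} z∈s x∈s y∈pair with x∈p∪q⁻ ⁅ z ⁆ ⁅ x ⁆ y∈pair
... | inj₁ y∈⁅z⁆ = x∈p⇒⁅x⁆⊆p z∈s y∈⁅z⁆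
... | inj₂ y∈⁅x⁆ = x∈p⇒⁅x⁆⊆p x∈s y∈⁅x⁆

module _ {n} (G : Graph n) where
  open Graph G

  ⁅⁆-isTube : ∀ {x y : Fin n} → y ≢ x → IsTube G ⁅ x ⁆
  ⁅⁆-isTube {x} {y} y≢x =
    (x , x∈⁅x⁆ x) , (⊆⊤ , y , ∈⊤ , x≢y⇒x∉⁅y⁆ y≢x) , (x , x∈⁅x⁆ x) , walk
    where
    walk : ∀ a b → a ∈ ⁅ x ⁆ → b ∈ ⁅ x ⁆ → WalkIn Adj (_∈ ⁅ x ⁆) a b
    walk a b a∈ b∈ = subst₂ (WalkIn Adj (_∈ ⁅ x ⁆)) (sym (x∈⁅y⁆⇒x≡y x a∈)) (sym (x∈⁅y⁆⇒x≡y x b∈)) (here (x∈⁅x⁆ x))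

  pair-connected⇒adjacent : ∀ {z x} → z ≢ x → InducedConnected G (⁅ z ⁆ ∪ ⁅ x ⁆) → Adj z x
  pair-connected⇒adjacent {z} {x} z≢x (_ , walk) = first-step (walk z x (x∈p∪q⁺ (inj₁ (x∈⁅x⁆ z))) (x∈p∪q⁺ (inj₂ (x∈⁅x⁆ x)))) z≢x
    where
    first-step : ∀ {a b} → WalkIn Adj (_∈ ⁅ a ⁆ ∪ ⁅ b ⁆) a b → a ≢ b → Adj a b
    first-step (here _) a≢a = contradiction refl a≢a
    first-step {a} {b} (step {y = y} _ a~y w) _ with x∈p∪q⁻ ⁅ a ⁆ ⁅ b ⁆ (walk-start w)
    ... | inj₁ y∈⁅a⁆ = contradiction (subst (Adj a) (x∈⁅y⁆⇒x≡y a y∈⁅a⁆) a~y) irrefl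
    ... | inj₂ y∈⁅b⁆ = subst (Adj a) (x∈⁅y⁆⇒x≡y b y∈⁅b⁆) a~y

module NestedTubing {n} (G : Graph n) (T : Collection G) (nested-tubing : IsNestedTubing G T) where

  tube : ∀ {s} → T s → IsTube G s
  tube {s} = proj₁ (proj₁ (proj₁ nested-tubing)) s

  maximal : ∀ {t} → IsTube G t → (∀ s → T s → Compatible G s t) → T t
  maximal {t} = proj₂ (proj₁ nested-tubing) t

  nested : ∀ {s t} → T s → T t → s ⊆ t ⊎ t ⊆ s
  nested {s} {t} = proj₂ nested-tubing s t

  comparable⇒∈ : ∀ {t} → IsTube G t → (∀ s → T s → s ⊆ t ⊎ t ⊆ s) → T t
  comparable⇒∈ t-tube comparable = maximal t-tube λ s Ts → [ inj₁ , inj₂ ∘ inj₁ ]′ (comparable s Ts)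

  stable : ∀ {t} → IsTube G t → ¬ ¬ T t → T t
  stable {t} t-tube ¬¬Tt = comparable⇒∈ t-tube λ s Ts →
    decidable-stable (s ⊆? t ⊎-dec t ⊆? s) λ incomparable → ¬¬Tt (incomparable ∘ nested Ts)

  ⁅⁆-unique : ∀ {x y} → T ⁅ x ⁆ → T ⁅ y ⁆ → x ≡ y
  ⁅⁆-unique {x} {y} Tx Ty with nested Tx Ty
  ... | inj₁ ⁅x⁆⊆⁅y⁆ = x∈⁅y⁆⇒x≡y y (⁅x⁆⊆⁅y⁆ (x∈⁅x⁆ x))
  ... | inj₂ ⁅y⁆⊆⁅x⁆ = sym (x∈⁅y⁆⇒x≡y x (⁅y⁆⊆⁅x⁆ (x∈⁅x⁆ y)))

  ⁅⁆-⊆ : ∀ {x s} → T ⁅ x ⁆ → T s → x ∈ s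
  ⁅⁆-⊆ {x} {s} Tx Ts with nested Tx Ts | proj₁ (tube Ts)
  ... | inj₁ ⁅x⁆⊆s | _ = ⁅x⁆⊆s (x∈⁅x⁆ x)
  ... | inj₂ s⊆⁅x⁆ | y , y∈s = subst (_∈ s) (x∈⁅y⁆⇒x≡y x (s⊆⁅x⁆ y∈s)) y∈s

  ∈-all⇒⁅⁆ : ∀ {x} → IsTube G ⁅ x ⁆ → (∀ s → T s → x ∈ s) → T ⁅ x ⁆
  ∈-all⇒⁅⁆ x-tube x∈all = comparable⇒∈ x-tube λ s Ts → inj₂ (x∈p⇒⁅x⁆⊆p (x∈all s Ts))

module Flip {n} (G : Graph n) (T T' : Collection G)
            (N : IsNestedTubing G T) (N' : IsNestedTubing G T') (flip : DifferInOneTube G T T') where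

  private
    module N = NestedTubing G T N
    module N' = NestedTubing G T' N'

  removed added : Subset n
  removed = proj₁ flip
  added = proj₁ (proj₂ flip)

  removed∈ : T removed
  removed∈ = proj₁ (proj₁ (proj₂ (proj₂ flip)))

  removed∉ : ¬ T' removed
  removed∉ = proj₂ (proj₁ (proj₂ (proj₂ flip)))

  added∈ : T' added
  added∈ = proj₁ (proj₁ (proj₂ (proj₂ (proj₂ flip))))

  added∉ : ¬ T added
  added∉ = proj₂ (proj₁ (proj₂ (proj₂ (proj₂ flip))))

  kept : ∀ {s} → T s → s ≢ removed → T' s
  kept {s} Ts s≢removed = N'.stable (N.tube Ts) λ ¬T's →
    s≢removed (proj₁ (proj₂ (proj₂ (proj₂ (proj₂ flip)))) s Ts ¬T's)

  restored : ∀ {s} → T' s → s ≢ added → T s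
  restored {s} T's s≢added = N.stable (N'.tube T's) λ ¬Ts →
    s≢added (proj₂ (proj₂ (proj₂ (proj₂ (proj₂ flip)))) s T's ¬Ts)

  module SingletonRemoved {z} (removed≡⁅z⁆ : removed ≡ ⁅ z ⁆) where

    private
      Tz : T ⁅ z ⁆
      Tz = subst T removed≡⁅z⁆ removed∈

    z∉added : z ∉ added
    z∉added z∈added = removed∉ (subst T' (sym removed≡⁅z⁆) (N'.∈-all⇒⁅⁆ (N.tube Tz) z∈all))
      where
      z∈all : ∀ s → T' s → z ∈ s
      z∈all s T's with s ≟ˢ added
      ... | yes refl = z∈added
      ... | no s≢added = N.⁅⁆-⊆ Tz (restored T's s≢added)

    added-⊆ : ∀ {s} → T' s → s ≢ added → added ⊆ s
    added-⊆ T's s≢added with N'.nested T's added∈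
    ... | inj₁ s⊆added = contradiction (s⊆added (N.⁅⁆-⊆ Tz (restored T's s≢added))) z∉added
    ... | inj₂ added⊆s = added⊆s

    new : Fin n
    new = proj₁ (proj₁ (N'.tube added∈))

    new∈added : new ∈ added
    new∈added = proj₂ (proj₁ (N'.tube added∈))

    z≢new : z ≢ new
    z≢new z≡new = z∉added (subst (_∈ added) (sym z≡new) new∈added)

    new-singleton : T' ⁅ new ⁆
    new-singleton = N'.∈-all⇒⁅⁆ (⁅⁆-isTube G z≢new) new∈all
      where
      new∈all : ∀ s → T' s → new ∈ s
      new∈all s T's with s ≟ˢ added
      ... | yes refl = new∈added
      ... | no s≢added = added-⊆ T's s≢added new∈added

    new∈others : ∀ {s} → T s → s ≢ ⁅ z ⁆ → new ∈ s
    new∈others {s} Ts s≢⁅z⁆ = added-⊆ (kept Ts (λ s≡removed → s≢⁅z⁆ (trans s≡removed removed≡⁅z⁆)))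
                                     (λ s≡added → added∉ (subst T s≡added Ts)) new∈added

  singleton-after : ∀ {z} → T ⁅ z ⁆ → ∃ λ x → T' ⁅ x ⁆
  singleton-after {z} Tz with removed ≟ˢ ⁅ z ⁆
  ... | yes removed≡⁅z⁆ = new , new-singleton where open SingletonRemoved removed≡⁅z⁆
  ... | no removed≢⁅z⁆ = z , kept Tz (removed≢⁅z⁆ ∘ sym)

-- Facet-Hamiltonian cycles of nested tubings

module NestedFacetHamiltonianCycle {k} (G : Graph (suc (suc k))) (C : AssocCycle G)
         (facet-hamiltonian : IsFacetHamiltonian G C)
         (nested : ∀ i → IsNestedTubing G (AssocCycle.vertex C i)) where

  open Graph G
  open AssocCycle C
  open CyclicOrder {m}

  private
    module Tubing i = NestedTubing G (vertex i) (nested i)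
    module Step i = Flip G (vertex i) (vertex (next i)) (nested i) (nested (next i)) (edge i)

  ⁅_⁆-tube : ∀ x → IsTube G ⁅ x ⁆
  ⁅ x ⁆-tube = ⁅⁆-isTube G (punchInᵢ≢i x zero)

  facet-inhabited : ∀ {t} → IsTube G t → ∃ λ i → vertex i t
  facet-inhabited t-tube = proj₁ (facet-hamiltonian _ t-tube)

  abstract
    singleton-everywhere : ∀ i → ∃ λ z → vertex i ⁅ z ⁆
    singleton-everywhere = cycle-induction (λ i → ∃ λ z → vertex i ⁅ z ⁆)
      (zero , proj₂ (facet-inhabited ⁅ zero ⁆-tube)) (λ i (_ , Tz) → Step.singleton-after i Tz)

  bottom : Fin (suc m) → Fin (suc (suc k))
  bottom i = proj₁ (singleton-everywhere i)

  bottom∈ : ∀ i → vertex i ⁅ bottom i ⁆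
  bottom∈ i = proj₂ (singleton-everywhere i)

  bottom-unique : ∀ {i z} → vertex i ⁅ z ⁆ → bottom i ≡ z
  bottom-unique {i} = Tubing.⁅⁆-unique i (bottom∈ i)

  Arc : Fin (suc (suc k)) → Fin (suc m) → Set
  Arc z i = bottom i ≡ z

  arc-inhabited : ∀ z → ∃ (Arc z)
  arc-inhabited z with i , Tz ← facet-inhabited ⁅ z ⁆-tube = i , bottom-unique Tz

  arc-walk : ∀ {z i j} → Arc z i → Arc z j → WalkIn CycAdj (Arc z) i j
  arc-walk {z} {i} {j} zi zj = walk-map bottom-unique
    (proj₂ (facet-hamiltonian _ ⁅ z ⁆-tube) i j (singleton∈ zi) (singleton∈ zj))
    where
    singleton∈ : ∀ {l} → Arc z l → vertex l ⁅ z ⁆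
    singleton∈ {l} zl = subst (λ x → vertex l ⁅ x ⁆) zl (bottom∈ l)

  exit : ∀ z → ∃ λ e → Arc z e × ¬ Arc z (next e)
  exit z with any? (λ e → (bottom e Fin.≟ z) ×-dec ¬? (bottom (next e) Fin.≟ z))
  ... | yes found = found
  ... | no none = contradiction (trans (sym (proj₂ (arc-inhabited y))) (everywhere _)) (punchInᵢ≢i z zero)
    where
    y : Fin (suc (suc k))
    y = punchIn z zero
    everywhere : ∀ i → Arc z i
    everywhere = cycle-induction (Arc z) (proj₂ (arc-inhabited z)) λ i zi →
      decidable-stable (bottom (next i) Fin.≟ z) λ z∉next → none (i , zi , z∉next)

  exit-point : Fin (suc (suc k)) → Fin (suc m)
  exit-point z = proj₁ (exit z)

  exit-point∈ : ∀ z → Arc z (exit-point z)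
  exit-point∈ z = proj₁ (proj₂ (exit z))

  exit-point-leaves : ∀ z → ¬ Arc z (next (exit-point z))
  exit-point-leaves z = proj₂ (proj₂ (exit z))

  successor : Fin (suc (suc k)) → Fin (suc (suc k))
  successor z = bottom (next (exit-point z))

  successor-step : ∀ {i} → bottom (next i) ≢ bottom i → successor (bottom i) ≡ bottom (next i)
  successor-step {i} moves = cong (bottom ∘ next)
    (exit-unique (Arc (bottom i)) (arc-walk (exit-point∈ (bottom i)) refl) (exit-point-leaves (bottom i)) moves)

  successor-injective : Injective _≡_ _≡_ successor
  successor-injective {z} {z'} same =
    trans (sym (exit-point∈ z)) (trans (cong bottom same-exit) (exit-point∈ z'))
    where
    same-exit : exit-point z ≡ exit-point z'
    same-exit = entry-unique (Arc (successor z')) (arc-walk same refl)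
      (λ e∈ → exit-point-leaves z (trans same (trans (sym e∈) (exit-point∈ z))))
      (λ e'∈ → exit-point-leaves z' (trans (sym e'∈) (exit-point∈ z')))

  successor-orbit : ∀ y → ∃ λ d → fold (bottom zero) successor d ≡ y
  successor-orbit y with i , iy ← arc-inhabited y = subst Reached iy (reached i)
    where
    Reached : Fin (suc (suc k)) → Set
    Reached x = ∃ λ d → fold (bottom zero) successor d ≡ x
    reached-next : ∀ i → Reached (bottom i) → Reached (bottom (next i))
    reached-next i (d , eq) with bottom (next i) Fin.≟ bottom i
    ... | yes stays = d , trans eq (sym stays)
    ... | no moves = suc d , trans (cong successor eq) (successor-step moves)
    reached : ∀ i → Reached (bottom i)
    reached = cycle-induction (Reached ∘ bottom) (0 , refl) reached-next

  never-removed⇒everywhere : ∀ {i s} → vertex i s → (∀ j → Step.removed j ≢ s) → ∀ j → vertex j s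
  never-removed⇒everywhere {s = s} Ts never =
    cycle-induction (λ j → vertex j s) Ts λ j Tjs → Step.kept j Tjs (never j ∘ sym)

  tube-not-everywhere : ∀ {s} → IsTube G s → ¬ (∀ j → vertex j s)
  tube-not-everywhere (_ , (_ , w , _ , w∉s) , _) everywhere with j , Tw ← facet-inhabited ⁅ w ⁆-tube =
    w∉s (Tubing.⁅⁆-⊆ j Tw (everywhere j))

  module _ (avoid-two : ∀ (p q : Fin (suc (suc k))) → ∃ λ w → w ≢ p × w ≢ q) where

    -- Maximality of vertex i only gives ¬ ¬ connectivity of ⁅ z ⁆ ∪ ⁅ x ⁆; an actual walk
    -- comes from a flip of this tube, which exists because no tube lies in every tubing.
    pair-adjacent : ∀ {i z x} → vertex i ⁅ z ⁆ → z ≢ x →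
                    (∀ {s} → vertex i s → s ≢ ⁅ z ⁆ → x ∈ s) → Adj z x
    pair-adjacent {i} {z} {x} Tz z≢x x∈others with any? (λ j → Step.removed j ≟ˢ (⁅ z ⁆ ∪ ⁅ x ⁆))
    ... | yes (j , removed≡pair) =
      pair-connected⇒adjacent G z≢x (proj₂ (proj₂ (subst (IsTube G) removed≡pair (Tubing.tube j (Step.removed∈ j)))))
    ... | no never = ⊥-elim (not-disconnected λ connected →
      tube-not-everywhere (pair-tube connected) (never-removed⇒everywhere (pair∈ connected) λ j eq → never (j , eq)))
      where
      pair : Subset (suc (suc k))
      pair = ⁅ z ⁆ ∪ ⁅ x ⁆
      not-disconnected : ¬ ¬ InducedConnected G pair
      not-disconnected disconnected = z≢x (Tubing.⁅⁆-unique i Tz (Tubing.maximal i ⁅ x ⁆-tube compatible))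
        where
        compatible : ∀ s → vertex i s → Compatible G s ⁅ x ⁆
        compatible s Ts with s ≟ˢ ⁅ z ⁆
        ... | yes refl = inj₂ (inj₂ disconnected)
        ... | no s≢⁅z⁆ = inj₂ (inj₁ (x∈p⇒⁅x⁆⊆p (x∈others Ts s≢⁅z⁆)))
      pair-tube : InducedConnected G pair → IsTube G pair
      pair-tube connected with w , w≢z , w≢x ← avoid-two z x =
        (z , x∈p∪q⁺ (inj₁ (x∈⁅x⁆ z))) , (⊆⊤ , w , ∈⊤ , [ x≢y⇒x∉⁅y⁆ w≢z , x≢y⇒x∉⁅y⁆ w≢x ]′ ∘ x∈p∪q⁻ ⁅ z ⁆ ⁅ x ⁆) , connected
      pair∈ : InducedConnected G pair → vertex i pair
      pair∈ connected = Tubing.comparable⇒∈ i (pair-tube connected) comparable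
        where
        comparable : ∀ s → vertex i s → s ⊆ pair ⊎ pair ⊆ s
        comparable s Ts with s ≟ˢ ⁅ z ⁆
        ... | yes refl = inj₁ (x∈p∪q⁺ ∘ inj₁)
        ... | no s≢⁅z⁆ = inj₂ (x∈p∧y∈p⇒⁅x⁆∪⁅y⁆⊆p (Tubing.⁅⁆-⊆ i Tz Ts) (x∈others Ts s≢⁅z⁆))

    bottom-step-adjacent : ∀ i → bottom (next i) ≢ bottom i → Adj (bottom i) (bottom (next i))
    bottom-step-adjacent i moves =
      subst (Adj (bottom i)) (sym (bottom-unique new-singleton)) (pair-adjacent (bottom∈ i) z≢new new∈others)
      where
      removed≡⁅bottom⁆ : Step.removed i ≡ ⁅ bottom i ⁆
      removed≡⁅bottom⁆ = decidable-stable (Step.removed i ≟ˢ ⁅ bottom i ⁆) λ removed≢ →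
        moves (bottom-unique (Step.kept i (bottom∈ i) (removed≢ ∘ sym)))
      open Step.SingletonRemoved i removed≡⁅bottom⁆

    successor-adjacent : ∀ z → Adj z (successor z)
    successor-adjacent z = subst (λ y → Adj y (successor z)) (exit-point∈ z)
      (bottom-step-adjacent (exit-point z) λ eq → exit-point-leaves z (trans eq (exit-point∈ z)))

  singleton-tubes⇒bottom-determines : (∀ {t} → IsTube G t → ∃ λ x → t ≡ ⁅ x ⁆) →
                                      ∀ {i j} → bottom i ≡ bottom j → SameTubing G (vertex i) (vertex j)
  singleton-tubes⇒bottom-determines singletons same t = mk⇔ (transfer same) (transfer (sym same))
    where
    transfer : ∀ {i j} → bottom i ≡ bottom j → vertex i t → vertex j t
    transfer {i} {j} same Tt with x , refl ← singletons (Tubing.tube i Tt) =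
      subst (λ y → vertex j ⁅ y ⁆) (trans (sym same) (bottom-unique Tt)) (bottom∈ j)

avoid-two : ∀ {k} (p q : Fin (suc (suc (suc k)))) → ∃ λ w → w ≢ p × w ≢ q
avoid-two {k} p q with p Fin.≟ q
... | yes refl = punchIn p zero , punchInᵢ≢i p zero , punchInᵢ≢i p zero
... | no p≢q = punchIn p (punchIn q′ zero) , punchInᵢ≢i p _ , λ eq →
  punchInᵢ≢i q′ zero (punchIn-injective p _ _ (trans eq (sym (punchIn-punchOut p≢q))))
  where
  q′ : Fin (suc (suc k))
  q′ = Fin.punchOut p≢q

no-tube-on-one-vertex : (G : Graph 1) {t : Subset 1} → ¬ IsTube G t
no-tube-on-one-vertex G ((zero , 0∈t) , (_ , zero , _ , 0∉t) , _) = 0∉t 0∈t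

tubings-on-one-vertex-coincide : (G : Graph 1) {T T' : Collection G} → IsTubing G T → IsTubing G T' → SameTubing G T T'
tubings-on-one-vertex-coincide G (tubes , _) (tubes' , _) t = mk⇔
  (λ Tt → contradiction (tubes t Tt) (no-tube-on-one-vertex G))
  (λ T't → contradiction (tubes' t T't) (no-tube-on-one-vertex G))

tube-on-two-vertices : (G : Graph 2) {t : Subset 2} → IsTube G t → ∃ λ x → t ≡ ⁅ x ⁆
tube-on-two-vertices G {true ∷ true ∷ []} (_ , (_ , y , _ , y∉t) , _) = contradiction ∈⊤ y∉t
tube-on-two-vertices G {true ∷ false ∷ []} _ = zero , refl
tube-on-two-vertices G {false ∷ true ∷ []} _ = suc zero , refl
tube-on-two-vertices G {false ∷ false ∷ []} ((x , x∈t) , _) = contradiction x∈t ∉⊥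

distinguishing-labels≥3 : ∀ {n k} {G : Graph n} (C : AssocCycle G) (label : Fin (suc (AssocCycle.m C)) → Fin k) →
  (∀ {i j} → label i ≡ label j → SameTubing G (AssocCycle.vertex C i) (AssocCycle.vertex C j)) → 3 ≤ k
distinguishing-labels≥3 C label same-label =
  ≤-trans (s≤s length≥3) (injective⇒≤ {f = label} λ eq → distinct _ _ (same-label eq))
  where open AssocCycle C

mainTheorem8 : ∀ {n} (G : Graph n) → IsConnectedGraph G →
    (C : AssocCycle G) → IsFacetHamiltonian G C →
    (∀ i → IsNestedTubing G (AssocCycle.vertex C i)) →
    HasHamiltonianCycle G
mainTheorem8 {zero} G ((() , _) , _) C facet-hamiltonian nested
mainTheorem8 {1} G _ C facet-hamiltonian nested =
  contradiction (distinguishing-labels≥3 {k = 1} C (λ _ → zero) λ {i} {j} _ → tubings-on-one-vertex-coincide G (tubing i) (tubing j))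
                λ { (s≤s ()) }
  where
  tubing : ∀ i → IsTubing G (AssocCycle.vertex C i)
  tubing i = proj₁ (proj₁ (nested i))
mainTheorem8 {2} G _ C facet-hamiltonian nested =
  contradiction (distinguishing-labels≥3 C bottom (singleton-tubes⇒bottom-determines (tube-on-two-vertices G)))
                λ { (s≤s (s≤s ())) }
  where open NestedFacetHamiltonianCycle G C facet-hamiltonian nested
mainTheorem8 {suc (suc (suc k))} G _ C facet-hamiltonian nested =
  hamiltonian-cycle-from-successor G (s≤s (s≤s (s≤s z≤n))) successor successor-injective
    (successor-adjacent avoid-two) (bottom zero) successor-orbit
  where open NestedFacetHamiltonianCycle G C facet-hamiltonian nested
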